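{- Let $n\ge3$, $\lambda\in\mathbb{Z}_{\ge0}^n$, and let $(x_1,\dots,x_n)$ be a positive integer solution of \[ \sum_{i=1}^n X_i^2+\sum_{i=1}^n \lambda_i\, X_1\cdots\widehat{X_i}\cdots X_n=\Big(n+\sum_{i=1}^n\lambda_i\Big)\prod_{i=1}^n X_i . \] If $x_j$ is not the largest coordinate, i.e. $x_j<\max_i x_i$, then after the mutation $\mu_j$ the $j$-th coordinate is strictly the largest: $(\mu_j(x_1,\dots,x_n))_j>(\mu_j(x_1,\dots,x_n))_i$ for all $i\ne j$.
   Context: $\widehat{X_i}$ denotes an omitted factor. The mutation $\mu_j$ replaces $x_j$ by $x_j'=\big(\sum_{i\ne j}x_i^2+\lambda_j\prod_{i\ne j}x_i\big)/x_j$ and leaves all other coordinates unchanged. -}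

module Defs where

open import Data.Nat using (ℕ; zero; suc; _+_; _*_; _<_)
open import Data.Nat.DivMod using (_/_)
open import Data.Fin using (Fin; _≟_)
open import Relation.Nullary using (yes; no)
open import Relation.Binary.PropositionalEquality using (_≡_)

∑ : ∀ {n} → (Fin n → ℕ) → ℕ
∑ {zero}  f = 0
∑ {suc n} f = f Fin.zero + ∑ (λ i → f (Fin.suc i))

∏ : ∀ {n} → (Fin n → ℕ) → ℕ
∏ {zero}  f = 1
∏ {suc n} f = f Fin.zero * ∏ (λ i → f (Fin.suc i))

-- f with the j-th value replaced by 1 (so ∏ (omit j f) = ∏_{i ≠ j} f i)
omit : ∀ {n} → Fin n → (Fin n → ℕ) → Fin n → ℕ
omit j f i with i ≟ j
... | yes _ = 1
... | no  _ = f i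

-- f with the j-th value replaced by 0 (so ∑ (drop0 j f) = ∑_{i ≠ j} f i)
drop0 : ∀ {n} → Fin n → (Fin n → ℕ) → Fin n → ℕ
drop0 j f i with i ≟ j
... | yes _ = 0
... | no  _ = f i

sq : ℕ → ℕ
sq a = a * a

lhs : ∀ {n} → (Fin n → ℕ) → (Fin n → ℕ) → ℕ
lhs {n} lam x = ∑ (λ i → sq (x i)) + ∑ (λ i → lam i * ∏ (omit i x))

rhs : ∀ {n} → (Fin n → ℕ) → (Fin n → ℕ) → ℕ
rhs {n} lam x = (n + ∑ lam) * ∏ x

IsSolution : ∀ {n} → (Fin n → ℕ) → (Fin n → ℕ) → Set
IsSolution lam x = lhs lam x ≡ rhs lam x

-- natural-number division, total (value 0 when dividing by 0; never used in
-- that case since the solution is positive)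
divN : ℕ → ℕ → ℕ
divN a zero    = 0
divN a (suc b) = a / suc b

-- the mutation μ_j:
--   x_j' = (∑_{i≠j} x_i² + λ_j ∏_{i≠j} x_i) / x_j, other coordinates unchanged.
-- (For positive solutions the division is exact, by the Vieta relation.)
mutate : ∀ {n} → (Fin n → ℕ) → Fin n → (Fin n → ℕ) → Fin n → ℕ
mutate lam j x i with i ≟ j
... | yes _ = divN (∑ (drop0 j (λ k → sq (x k))) + lam j * ∏ (omit j x)) (x j)
... | no  _ = x i

{-# OPTIONS --safe #-}
module Submission where

-- Let a = x_j < x_k and M = max(x_i, x_k), so a < M.  The numerator of x_j' contains
-- M² as one of its squares, and a < M gives a(M + 1) ≤ M², hence x_i ≤ M < M²/a ≤ x_j'.

open import Defs
open import Data.Nat using (ℕ; suc; _+_; _*_; _≤_; _<_; _⊔_)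
open import Data.Nat.Properties
  using (≤-refl; ≤-trans; <⇒≤; <-irrefl; ≤-<-trans; <-≤-trans; m≤m+n; m≤n+m; m≤m⊔n; m≤n⊔m;
         ⊔-sel; *-comm; *-suc; +-monoˡ-≤; *-monoˡ-≤; module ≤-Reasoning)
open import Data.Nat.DivMod using (_/_; m*n/n≡m; /-monoˡ-≤)
open import Data.Fin using (Fin; _≟_)
open import Data.Product using (∃; _,_)
open import Data.Sum using (inj₁; inj₂)
open import Relation.Nullary using (yes; no; contradiction)
open import Relation.Binary.PropositionalEquality using (_≡_; _≢_; refl; sym; subst)

term≤∑ : ∀ {n} (f : Fin n → ℕ) i → f i ≤ ∑ f
term≤∑ f Fin.zero    = m≤m+n _ _
term≤∑ f (Fin.suc i) = ≤-trans (term≤∑ (λ k → f (Fin.suc k)) i) (m≤n+m _ _)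

drop0-other : ∀ {n} (j : Fin n) f {i} → i ≢ j → drop0 j f i ≡ f i
drop0-other j f {i} i≢j with i ≟ j
... | yes i≡j = contradiction i≡j i≢j
... | no  _   = refl

term≤∑-drop0 : ∀ {n} (j : Fin n) f {i} → i ≢ j → f i ≤ ∑ (drop0 j f)
term≤∑-drop0 j f {i} i≢j = subst (_≤ ∑ (drop0 j f)) (drop0-other j f i≢j) (term≤∑ (drop0 j f) i)

mutate-self : ∀ {n} lam (j : Fin n) x →
  mutate lam j x j ≡ divN (∑ (drop0 j (λ k → sq (x k))) + lam j * ∏ (omit j x)) (x j)
mutate-self lam j x with j ≟ j
... | yes _   = refl
... | no  j≢j = contradiction refl j≢j

mutate-other : ∀ {n} lam (j : Fin n) x {i} → i ≢ j → mutate lam j x i ≡ x i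
mutate-other lam j x {i} i≢j with i ≟ j
... | yes i≡j = contradiction i≡j i≢j
... | no  _   = refl

*-suc≤sq : ∀ {a m} → a < m → a * suc m ≤ sq m
*-suc≤sq {a} {m} a<m = begin
  a * suc m  ≡⟨ *-suc a m ⟩
  a + a * m  ≤⟨ +-monoˡ-≤ (a * m) (<⇒≤ a<m) ⟩
  suc a * m  ≤⟨ *-monoˡ-≤ m a<m ⟩
  m * m      ∎
  where open ≤-Reasoning

<-divN : ∀ {a m t} → 0 < a → a * suc m ≤ t → m < divN t a
<-divN {suc a} {m} {t} _ a*[1+m]≤t = begin-strict
  m                        <⟨ ≤-refl ⟩
  suc m                    ≡⟨ sym (m*n/n≡m (suc m) (suc a)) ⟩
  suc m * suc a / suc a    ≤⟨ /-monoˡ-≤ (suc a) (subst (_≤ t) (*-comm (suc a) (suc m)) a*[1+m]≤t) ⟩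
  t / suc a                ∎
  where open ≤-Reasoning

sq-⊔-≤ : ∀ {m n s} → sq m ≤ s → sq n ≤ s → sq (m ⊔ n) ≤ s
sq-⊔-≤ {m} {n} m²≤s n²≤s with ⊔-sel m n
... | inj₁ m⊔n≡m = subst (λ v → sq v ≤ _) (sym m⊔n≡m) m²≤s
... | inj₂ m⊔n≡n = subst (λ v → sq v ≤ _) (sym m⊔n≡n) n²≤s

proposition2p5 : (n : ℕ) → 3 ≤ n → (lam : Fin n → ℕ) → (x : Fin n → ℕ)
    → (∀ i → 0 < x i) → IsSolution lam x
    → (j : Fin n) → ∃ (λ k → x j < x k)
    → ∀ (i : Fin n) → i ≢ j → mutate lam j x i < mutate lam j x j
proposition2p5 n _ lam x pos _ j (k , xj<xk) i i≢j
  rewrite mutate-self lam j x | mutate-other lam j x i≢j =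
  ≤-<-trans (m≤m⊔n (x i) (x k)) (<-divN (pos j) (begin
    x j * suc M                             ≤⟨ *-suc≤sq (<-≤-trans xj<xk (m≤n⊔m (x i) (x k))) ⟩
    sq M                                    ≤⟨ sq-⊔-≤ {x i} {x k} (term≤∑-drop0 j x² i≢j) (term≤∑-drop0 j x² k≢j) ⟩
    ∑ (drop0 j x²)                          ≤⟨ m≤m+n _ _ ⟩
    ∑ (drop0 j x²) + lam j * ∏ (omit j x)   ∎))
  where
  open ≤-Reasoning
  M : ℕ
  M = x i ⊔ x k
  x² : Fin n → ℕ
  x² l = sq (x l)
  k≢j : k ≢ j
  k≢j refl = <-irrefl refl xj<xk
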